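{- Let $\mathfrak{B}$ be the set of open intervals of $\mathbb{R}$ with computable real centers and positive rational radii, with numbering $\text{dom}(\beta)=\{\langle n,m\rangle:n\in\text{dom}(c_{\mathbb{R}}),\ c_{\mathbb{Q}}(m)>0\}$, $\beta(\langle n,m\rangle)=]c_{\mathbb{R}}(n)-c_{\mathbb{Q}}(m),\,c_{\mathbb{R}}(n)+c_{\mathbb{Q}}(m)[$, and semi-decidable strong inclusion $\langle n_1,m_1\rangle\mathring{\subseteq}\langle n_2,m_2\rangle\iff|c_{\mathbb{R}}(n_1)-c_{\mathbb{R}}(n_2)|+c_{\mathbb{Q}}(m_1)<c_{\mathbb{Q}}(m_2)$. Let $\tilde\beta:\mathbb{N}\to\mathfrak{B}\cup\{\emptyset\}$ be the totalization: $\tilde\beta(n)=\beta(n)$ for $n\in\text{dom}(\beta)$ and $\tilde\beta(n)=\emptyset$ otherwise. Then there is no semi-decidable strong inclusion relation $\mathring{\subseteq}'$ for $(\mathfrak{B}\cup\{\emptyset\},\tilde\beta)$ that extends $\mathring{\subseteq}$.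
   Context: $c_{\mathbb{Q}}$ is a standard total numbering of $\mathbb{Q}$, $\langle\cdot,\cdot\rangle$ a computable pairing, $\varphi_n$ the $n$-th partial computable function. $c_{\mathbb{R}}$ is the usual (Cauchy) numbering of computable reals: $n\in\text{dom}(c_{\mathbb{R}})$ iff $\varphi_n$ is total and $|c_{\mathbb{Q}}(\varphi_n(i))-c_{\mathbb{Q}}(\varphi_n(j))|\le 2^{ -j}$ for $i>j$ (Cauchy with fixed rate), and $c_{\mathbb{R}}(n)=\lim_i c_{\mathbb{Q}}(\varphi_n(i))$. A strong inclusion relation for a numbered family $(\mathfrak{C},\gamma)$ of sets is a transitive relation $R$ on $\text{dom}(\gamma)$ such that $b_1Rb_2$ implies $\gamma(b_1)\subseteq\gamma(b_2)$; here $\text{dom}(\tilde\beta)=\mathbb{N}$. $\mathring{\subseteq}'$ extends $\mathring{\subseteq}$ means that they agree on $\text{dom}(\beta)\times\text{dom}(\beta)$. Semi-decidable means there is an algorithm which on input $(a,b)$ halts iff $a\mathring{\subseteq}'b$. -}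

module Defs where

open import Data.Nat as ℕ using (ℕ; zero; suc; _+_)
open import Data.Product using (Σ; _×_; _,_; proj₁; proj₂; ∃)
open import Data.Maybe using (Maybe; just; nothing; _>>=_)
open import Data.Integer using (+_)
open import Data.Rational using (ℚ; _/_; _-_; _*_; ∣_∣; _<_; _≤_; 1ℚ; ½; 0ℚ)
import Data.Rational as ℚ
open import Relation.Binary.PropositionalEquality using (_≡_)
open import Function.Bundles using (_⇔_)

tri : ℕ → ℕ
tri zero    = zero
tri (suc d) = tri d + suc d

⟨_,_⟩ : ℕ → ℕ → ℕ
⟨ x , y ⟩ = tri (x + y) + y

unpair : ℕ → ℕ × ℕ
unpair zero = zero , zero
unpair (suc n) with unpair n
... | zero    , y = suc y , zero
... | suc x   , y = x , suc y

π₁ π₂ : ℕ → ℕ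
π₁ n = proj₁ (unpair n)
π₂ n = proj₂ (unpair n)

cQ : ℕ → ℚ
cQ n with π₁ n
... | zero  = (+ π₁ (π₂ n)) / suc (π₂ (π₂ n))
... | suc _ = ℚ.- ((+ π₁ (π₂ n)) / suc (π₂ (π₂ n)))

data Code : Set where
  Z S I L R : Code                 -- 0, successor, identity, π₁, π₂
  P   : Code → Code → Code
  C   : Code → Code → Code
  Rec : Code → Code → Code         -- h⟨x,0⟩ = f x ; h⟨x,y+1⟩ = g⟨x,⟨y,h⟨x,y⟩⟩⟩
  Mu  : Code → Code                -- x ↦ least y with f⟨x,y⟩ = 0 (all earlier defined)

recWith : (ℕ → Maybe ℕ) → (ℕ → Maybe ℕ) → ℕ → ℕ → Maybe ℕ
recWith f g x zero    = f x
recWith f g x (suc y) = recWith f g x y >>= λ h → g ⟨ x , ⟨ y , h ⟩ ⟩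

searchWith : (ℕ → Maybe ℕ) → ℕ → ℕ → ℕ → Maybe ℕ
searchWith f x zero    i = nothing
searchWith f x (suc r) i = f ⟨ x , i ⟩ >>= λ where
  zero    → just i
  (suc _) → searchWith f x r (suc i)

eval : ℕ → Code → ℕ → Maybe ℕ
eval zero    _         _ = nothing
eval (suc k) Z         x = just zero
eval (suc k) S         x = just (suc x)
eval (suc k) I         x = just x
eval (suc k) L         x = just (π₁ x)
eval (suc k) R         x = just (π₂ x)
eval (suc k) (P f g)   x = eval k f x >>= λ a → eval k g x >>= λ b → just ⟨ a , b ⟩
eval (suc k) (C f g)   x = eval k g x >>= eval k f
eval (suc k) (Rec f g) x = recWith (eval k f) (eval k g) (π₁ x) (π₂ x)
eval (suc k) (Mu f)    x = searchWith (eval k f) x k zero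

decodeF : ℕ → ℕ → Code
decodeF zero    n = Z
decodeF (suc f) n with π₁ n
... | 0 = Z
... | 1 = S
... | 2 = I
... | 3 = L
... | 4 = R
... | 5 = P   (decodeF f (π₁ (π₂ n))) (decodeF f (π₂ (π₂ n)))
... | 6 = C   (decodeF f (π₁ (π₂ n))) (decodeF f (π₂ (π₂ n)))
... | 7 = Rec (decodeF f (π₁ (π₂ n))) (decodeF f (π₂ (π₂ n)))
... | 8 = Mu  (decodeF f (π₁ (π₂ n)))
... | _ = Z

decode : ℕ → Code
decode n = decodeF (suc n) n

_·_↓_ : ℕ → ℕ → ℕ → Set
e · x ↓ y = ∃ λ k → eval k (decode e) x ≡ just y

Halts : ℕ → ℕ → Set
Halts e x = ∃ λ y → e · x ↓ y

eps : ℕ → ℚ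
eps zero    = 1ℚ
eps (suc j) = ½ * eps j

record ℝ : Set where
  field
    seq : ℕ → ℚ
    reg : ∀ i j → j ℕ.< i → ∣ seq i - seq j ∣ ≤ eps j
open ℝ public

-- |x - y| < q  for reals x y and rational q
-- (since |x - x_j| ≤ 2^{-j}, this holds iff some approximation witnesses it)
Dist<_,_∣_ : ℝ → ℝ → ℚ → Set
Dist< x , y ∣ q = ∃ λ j → (eps j ℚ.+ eps j) < q - ∣ seq x j - seq y j ∣

record DomR (n : ℕ) : Set where
  field
    total  : ∀ i → ∃ λ v → n · i ↓ v
    cauchy : ∀ i j → j ℕ.< i →
             ∣ cQ (proj₁ (total i)) - cQ (proj₁ (total j)) ∣ ≤ eps j

cR : (n : ℕ) → DomR n → ℝ
cR n d = record
  { seq = λ i → cQ (proj₁ (DomR.total d i))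
  ; reg = DomR.cauchy d }

Domβ : ℕ → Set
Domβ b = DomR (π₁ b) × (0ℚ < cQ (π₂ b))

centre : (b : ℕ) → Domβ b → ℝ
centre b d = cR (π₁ b) (proj₁ d)

radius : ℕ → ℚ
radius b = cQ (π₂ b)

-- x ∈ β̃(b)  (β̃(b) = ∅ outside dom(β))
_∈β̃_ : ℝ → ℕ → Set
x ∈β̃ b = Σ (Domβ b) λ d → Dist< centre b d , x ∣ radius b

_⊆β̃_ : ℕ → ℕ → Set
a ⊆β̃ b = ∀ x → x ∈β̃ a → x ∈β̃ b

StrongIncl : (a b : ℕ) → Domβ a → Domβ b → Set
StrongIncl a b da db = Dist< centre a da , centre b db ∣ (radius b - radius a)

Transitive′ : (ℕ → ℕ → Set) → Set
Transitive′ R′ = ∀ a b c → R′ a b → R′ b c → R′ a c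

IsStrongInclusionβ̃ : (ℕ → ℕ → Set) → Set
IsStrongInclusionβ̃ R′ = Transitive′ R′ × (∀ a b → R′ a b → a ⊆β̃ b)

Extends : (ℕ → ℕ → Set) → Set
Extends R′ = ∀ a b (da : Domβ a) (db : Domβ b) → R′ a b ⇔ StrongIncl a b da db

SemiDecidable : (ℕ → ℕ → Set) → Set
SemiDecidable R′ = ∃ λ e → ∀ a b → R′ a b ⇔ Halts e ⟨ a , b ⟩

-- Suppose e semi-decides an extension R′ of ⊆̊, and let u = ]-1, 1[. By a diagonal
-- construction (the trick behind the recursion theorem) there is an index p such that
-- φ_p(i) = 0 as long as e has not accepted ⟨u , ⟨p , 9⟩⟩ within i steps, and φ_p(i)
-- diverges once it has; ⟨p , 9⟩ has radius 2. If e accepts, then β̃(u) ⊆ β̃⟨p , 9⟩, and as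
-- 0 ∈ β̃(u) the index ⟨p , 9⟩ lies in dom(β), i.e. φ_p is total: impossible. So e never
-- accepts; but then φ_p is the constant 0, u ⊆̊ ⟨p , 9⟩ = ]-2, 2[, and e accepts after all.
-- Watching e for i steps needs, for each code, a code computing its fuel-bounded
-- evaluation; it is built by recursion on the code.
module Submission where

open import Defs
open import Data.Empty using (⊥; ⊥-elim)
open import Data.Maybe using (Maybe; just; nothing; _>>=_)
open import Data.Maybe.Properties using (just-injective)
open import Data.Nat using (ℕ; zero; suc; _+_; _∸_; _⊔_; _≤_; _<_; z≤n; s≤s; pred; _≤′_; ≤′-refl; ≤′-step)
open import Data.Nat.Properties
open import Data.Product using (Σ; ∃; _×_; _,_; proj₁; proj₂)
open import Data.Rational using (0ℚ; 1ℚ; ½)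
import Data.Rational as ℚ
import Data.Rational.Properties as ℚₚ
open import Function using (_∘_; case_of_)
open import Function.Bundles using (Equivalence; _⇔_)
open import Relation.Binary.PropositionalEquality
open import Relation.Nullary using (¬_)
open import Relation.Nullary.Decidable using (from-yes)

⟨1+y,0⟩≡1+⟨0,y⟩ : ∀ y → ⟨ suc y , 0 ⟩ ≡ suc ⟨ 0 , y ⟩
⟨1+y,0⟩≡1+⟨0,y⟩ y = begin
  tri (suc y + 0) + 0  ≡⟨ +-identityʳ _ ⟩
  tri (suc y + 0)      ≡⟨ cong (tri ∘ suc) (+-identityʳ y) ⟩
  tri y + suc y        ≡⟨ +-suc (tri y) y ⟩
  suc (tri y + y)      ∎
  where open ≡-Reasoning

⟨x,1+y⟩≡1+⟨1+x,y⟩ : ∀ x y → ⟨ x , suc y ⟩ ≡ suc ⟨ suc x , y ⟩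
⟨x,1+y⟩≡1+⟨1+x,y⟩ x y = trans (cong (λ d → tri d + suc y) (+-suc x y)) (+-suc _ y)

⟨π₁,π₂⟩ : ∀ n → ⟨ π₁ n , π₂ n ⟩ ≡ n
⟨π₁,π₂⟩ zero = refl
⟨π₁,π₂⟩ (suc n) with unpair n | ⟨π₁,π₂⟩ n
... | zero  , y | eq = trans (⟨1+y,0⟩≡1+⟨0,y⟩ y) (cong suc eq)
... | suc x , y | eq = trans (⟨x,1+y⟩≡1+⟨1+x,y⟩ x y) (cong suc eq)

unpair-inverseˡ : ∀ n x y → ⟨ x , y ⟩ ≡ n → unpair n ≡ (x , y)
unpair-inverseˡ zero    zero    zero    _  = refl
unpair-inverseˡ zero    (suc x) zero    eq = ⊥-elim (1+n≢0 (trans (sym (⟨1+y,0⟩≡1+⟨0,y⟩ x)) eq))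
unpair-inverseˡ zero    x       (suc y) eq = ⊥-elim (1+n≢0 (trans (sym (⟨x,1+y⟩≡1+⟨1+x,y⟩ x y)) eq))
unpair-inverseˡ (suc n) zero    zero    ()
unpair-inverseˡ (suc n) (suc x) zero    eq
  rewrite unpair-inverseˡ n zero x (suc-injective (trans (sym (⟨1+y,0⟩≡1+⟨0,y⟩ x)) eq)) = refl
unpair-inverseˡ (suc n) x       (suc y) eq
  rewrite unpair-inverseˡ n (suc x) y (suc-injective (trans (sym (⟨x,1+y⟩≡1+⟨1+x,y⟩ x y)) eq)) = refl

π₁-⟨,⟩ : ∀ x y → π₁ ⟨ x , y ⟩ ≡ x
π₁-⟨,⟩ x y = cong proj₁ (unpair-inverseˡ _ x y refl)

π₂-⟨,⟩ : ∀ x y → π₂ ⟨ x , y ⟩ ≡ y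
π₂-⟨,⟩ x y = cong proj₂ (unpair-inverseˡ _ x y refl)

n≤tri[n] : ∀ n → n ≤ tri n
n≤tri[n] zero    = z≤n
n≤tri[n] (suc n) = m≤n+m (suc n) (tri n)

x≤⟨x,y⟩ : ∀ x y → x ≤ ⟨ x , y ⟩
x≤⟨x,y⟩ x y = ≤-trans (m≤m+n x y) (≤-trans (n≤tri[n] (x + y)) (m≤m+n _ y))

y≤⟨x,y⟩ : ∀ x y → y ≤ ⟨ x , y ⟩
y≤⟨x,y⟩ x y = m≤n+m y _

y<⟨1+x,y⟩ : ∀ x y → y < ⟨ suc x , y ⟩
y<⟨1+x,y⟩ x y = ≤-trans (s≤s (m≤n+m y x)) (≤-trans (n≤tri[n] (suc x + y)) (m≤m+n _ y))

π₁≤ : ∀ n → π₁ n ≤ n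
π₁≤ n = subst (π₁ n ≤_) (⟨π₁,π₂⟩ n) (x≤⟨x,y⟩ (π₁ n) (π₂ n))

π₂≤ : ∀ n → π₂ n ≤ n
π₂≤ n = subst (π₂ n ≤_) (⟨π₁,π₂⟩ n) (y≤⟨x,y⟩ (π₁ n) (π₂ n))

π₂< : ∀ n {t} → π₁ n ≡ suc t → π₂ n < n
π₂< n {t} tag =
  subst (π₂ n <_) (⟨π₁,π₂⟩ n) (subst (λ x → π₂ n < ⟨ x , π₂ n ⟩) (sym tag) (y<⟨1+x,y⟩ t (π₂ n)))

module _ {n t F : ℕ} (tag : π₁ n ≡ suc t) (n<1+F : n < suc F) where

  π₁∘π₂< : π₁ (π₂ n) < F
  π₁∘π₂< = ≤-<-trans (π₁≤ (π₂ n)) (<-≤-trans (π₂< n tag) (≤-pred n<1+F))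

  π₂∘π₂< : π₂ (π₂ n) < F
  π₂∘π₂< = ≤-<-trans (π₂≤ (π₂ n)) (<-≤-trans (π₂< n tag) (≤-pred n<1+F))

decodeF-stable : ∀ F G n → n < F → n < G → decodeF F n ≡ decodeF G n
decodeF-stable (suc F) (suc G) n n<F n<G with π₁ n in tag
... | 0 = refl
... | 1 = refl
... | 2 = refl
... | 3 = refl
... | 4 = refl
... | 5 = cong₂ P (decodeF-stable F G _ (π₁∘π₂< tag n<F) (π₁∘π₂< tag n<G))
                 (decodeF-stable F G _ (π₂∘π₂< tag n<F) (π₂∘π₂< tag n<G))
... | 6 = cong₂ C (decodeF-stable F G _ (π₁∘π₂< tag n<F) (π₁∘π₂< tag n<G))
                 (decodeF-stable F G _ (π₂∘π₂< tag n<F) (π₂∘π₂< tag n<G))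
... | 7 = cong₂ Rec (decodeF-stable F G _ (π₁∘π₂< tag n<F) (π₁∘π₂< tag n<G))
                   (decodeF-stable F G _ (π₂∘π₂< tag n<F) (π₂∘π₂< tag n<G))
... | 8 = cong Mu (decodeF-stable F G _ (π₁∘π₂< tag n<F) (π₁∘π₂< tag n<G))
... | suc (suc (suc (suc (suc (suc (suc (suc (suc _)))))))) = refl

DecodesAs : ℕ → (Code → Code → Code) → Set
DecodesAs t node = ∀ F n → π₁ n ≡ t →
  decodeF (suc F) n ≡ node (decodeF F (π₁ (π₂ n))) (decodeF F (π₂ (π₂ n)))

decodesAs-P : DecodesAs 5 P
decodesAs-P F n tag with π₁ n | tag
... | _ | refl = refl

decodesAs-C : DecodesAs 6 C
decodesAs-C F n tag with π₁ n | tag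
... | _ | refl = refl

decodesAs-Rec : DecodesAs 7 Rec
decodesAs-Rec F n tag with π₁ n | tag
... | _ | refl = refl

decodesAs-Mu : DecodesAs 8 (λ f _ → Mu f)
decodesAs-Mu F n tag with π₁ n | tag
... | _ | refl = refl

decode-node : ∀ {t} node → DecodesAs (suc t) node →
              ∀ a b → decode ⟨ suc t , ⟨ a , b ⟩ ⟩ ≡ node (decode a) (decode b)
decode-node {t} node decodesAs a b = begin
  decode N
    ≡⟨ decodesAs N N (π₁-⟨,⟩ (suc t) _) ⟩
  node (decodeF N (π₁ (π₂ N))) (decodeF N (π₂ (π₂ N)))
    ≡⟨ cong₂ (λ x y → node (decodeF N x) (decodeF N y))
             (trans (cong π₁ π₂N) (π₁-⟨,⟩ a b)) (trans (cong π₂ π₂N) (π₂-⟨,⟩ a b)) ⟩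
  node (decodeF N a) (decodeF N b)
    ≡⟨ cong₂ node (decodeF-stable N (suc a) a a<N ≤-refl) (decodeF-stable N (suc b) b b<N ≤-refl) ⟩
  node (decode a) (decode b) ∎
  where
  open ≡-Reasoning
  N : ℕ
  N = ⟨ suc t , ⟨ a , b ⟩ ⟩
  π₂N : π₂ N ≡ ⟨ a , b ⟩
  π₂N = π₂-⟨,⟩ (suc t) _
  a<N : a < N
  a<N = ≤-<-trans (x≤⟨x,y⟩ a b) (y<⟨1+x,y⟩ t _)
  b<N : b < N
  b<N = ≤-<-trans (y≤⟨x,y⟩ a b) (y<⟨1+x,y⟩ t _)

encode : Code → ℕ
encode Z         = 0
encode S         = ⟨ 1 , 0 ⟩
encode I         = ⟨ 2 , 0 ⟩
encode L         = ⟨ 3 , 0 ⟩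
encode R         = ⟨ 4 , 0 ⟩
encode (P f g)   = ⟨ 5 , ⟨ encode f , encode g ⟩ ⟩
encode (C f g)   = ⟨ 6 , ⟨ encode f , encode g ⟩ ⟩
encode (Rec f g) = ⟨ 7 , ⟨ encode f , encode g ⟩ ⟩
encode (Mu f)    = ⟨ 8 , ⟨ encode f , 0 ⟩ ⟩

decode-encode : ∀ c → decode (encode c) ≡ c
decode-encode Z         = refl
decode-encode S         = refl
decode-encode I         = refl
decode-encode L         = refl
decode-encode R         = refl
decode-encode (P f g)   = trans (decode-node P decodesAs-P _ _) (cong₂ P (decode-encode f) (decode-encode g))
decode-encode (C f g)   = trans (decode-node C decodesAs-C _ _) (cong₂ C (decode-encode f) (decode-encode g))
decode-encode (Rec f g) = trans (decode-node Rec decodesAs-Rec _ _) (cong₂ Rec (decode-encode f) (decode-encode g))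
decode-encode (Mu f)    = trans (decode-node (λ f _ → Mu f) decodesAs-Mu _ _) (cong Mu (decode-encode f))

_⊑_ : (ℕ → Maybe ℕ) → (ℕ → Maybe ℕ) → Set
f ⊑ g = ∀ x {v} → f x ≡ just v → g x ≡ just v

>>=-just⁻¹ : ∀ (m : Maybe ℕ) {h : ℕ → Maybe ℕ} {v} → (m >>= h) ≡ just v → ∃ λ a → m ≡ just a × h a ≡ just v
>>=-just⁻¹ (just a) eq = a , refl , eq

recWith-mono : ∀ {f f′ g g′} → f ⊑ f′ → g ⊑ g′ → ∀ x y {v} →
               recWith f g x y ≡ just v → recWith f′ g′ x y ≡ just v
recWith-mono f⊑f′ g⊑g′ x zero    eq = f⊑f′ x eq
recWith-mono {f} {g = g} f⊑f′ g⊑g′ x (suc y) eq with >>=-just⁻¹ (recWith f g x y) eq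
... | h , eq₁ , eq₂ rewrite recWith-mono f⊑f′ g⊑g′ x y eq₁ = g⊑g′ _ eq₂

searchWith-mono : ∀ {f f′} → f ⊑ f′ → ∀ x r i {v} →
                  searchWith f x r i ≡ just v → searchWith f′ x (suc r) i ≡ just v
searchWith-mono f⊑f′ x zero    i ()
searchWith-mono {f} f⊑f′ x (suc r) i eq with >>=-just⁻¹ (f ⟨ x , i ⟩) eq
... | zero  , eq₁ , eq₂ rewrite f⊑f′ _ eq₁ = eq₂
... | suc _ , eq₁ , eq₂ rewrite f⊑f′ _ eq₁ = searchWith-mono f⊑f′ x r (suc i) eq₂

eval-mono-suc : ∀ k c → eval k c ⊑ eval (suc k) c
eval-mono-suc zero    c         x ()
eval-mono-suc (suc k) Z         x eq = eq
eval-mono-suc (suc k) S         x eq = eq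
eval-mono-suc (suc k) I         x eq = eq
eval-mono-suc (suc k) L         x eq = eq
eval-mono-suc (suc k) R         x eq = eq
eval-mono-suc (suc k) (P f g)   x eq with >>=-just⁻¹ (eval k f x) eq
... | a , eqa , eq′ with >>=-just⁻¹ (eval k g x) eq′
... | b , eqb , eq″ rewrite eval-mono-suc k f x eqa | eval-mono-suc k g x eqb = eq″
eval-mono-suc (suc k) (C f g)   x eq with >>=-just⁻¹ (eval k g x) eq
... | a , eqa , eq′ rewrite eval-mono-suc k g x eqa = eval-mono-suc k f a eq′
eval-mono-suc (suc k) (Rec f g) x eq = recWith-mono (eval-mono-suc k f) (eval-mono-suc k g) (π₁ x) (π₂ x) eq
eval-mono-suc (suc k) (Mu f)    x eq = searchWith-mono (eval-mono-suc k f) x k zero eq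

eval-mono′ : ∀ {k k′} c → k ≤′ k′ → eval k c ⊑ eval k′ c
eval-mono′ c ≤′-refl          x eq = eq
eval-mono′ c (≤′-step k≤′k′) x eq = eval-mono-suc _ c x (eval-mono′ c k≤′k′ x eq)

eval-mono : ∀ {k k′} c → k ≤ k′ → eval k c ⊑ eval k′ c
eval-mono c = eval-mono′ c ∘ ≤⇒≤′

eval-deterministic : ∀ {k k′} c x {v v′} → eval k c x ≡ just v → eval k′ c x ≡ just v′ → v ≡ v′
eval-deterministic {k} {k′} c x eq eq′ =
  just-injective (trans (sym (eval-mono c (m≤m⊔n k k′) x eq)) (eval-mono c (m≤n⊔m k k′) x eq′))

_⟦_⟧↓_ : Code → ℕ → ℕ → Set
c ⟦ x ⟧↓ v = ∃ λ k → eval k c x ≡ just v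

Computes : Code → (ℕ → ℕ) → Set
Computes c f = ∀ x → c ⟦ x ⟧↓ f x

computes-ext : ∀ {c f g} → Computes c f → (∀ x → f x ≡ g x) → Computes c g
computes-ext c↓f f≗g x = proj₁ (c↓f x) , trans (proj₂ (c↓f x)) (cong just (f≗g x))

computes-Z : Computes Z (λ _ → 0)
computes-Z x = 1 , refl

computes-S : Computes S suc
computes-S x = 1 , refl

computes-I : Computes I (λ x → x)
computes-I x = 1 , refl

computes-L : Computes L π₁
computes-L x = 1 , refl

computes-R : Computes R π₂
computes-R x = 1 , refl

computes-P : ∀ {f g F G} → Computes f F → Computes g G → Computes (P f g) (λ x → ⟨ F x , G x ⟩)
computes-P {f} {g} f↓F g↓G x with f↓F x | g↓G x
... | kf , eqf | kg , eqg = suc (kf ⊔ kg) , eval-P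
  where
  eval-P : eval (suc (kf ⊔ kg)) (P f g) x ≡ just _
  eval-P rewrite eval-mono f (m≤m⊔n kf kg) x eqf | eval-mono g (m≤n⊔m kf kg) x eqg = refl

↓-C : ∀ {f g G x v} → Computes g G → f ⟦ G x ⟧↓ v → C f g ⟦ x ⟧↓ v
↓-C {f} {g} {G} {x} g↓G (kf , eqf) with g↓G x
... | kg , eqg = suc (kf ⊔ kg) , eval-C
  where
  eval-C : eval (suc (kf ⊔ kg)) (C f g) x ≡ just _
  eval-C rewrite eval-mono g (m≤n⊔m kf kg) x eqg = eval-mono f (m≤m⊔n kf kg) (G x) eqf

↓-C⁻¹ : ∀ {f g G x v} → Computes g G → C f g ⟦ x ⟧↓ v → f ⟦ G x ⟧↓ v
↓-C⁻¹ {f} {g} {G} {x} g↓G (suc k , eq) with >>=-just⁻¹ (eval k g x) eq | g↓G x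
... | w , eqw , eq′ | kg , eqg = k , subst (λ y → eval k f y ≡ just _) (eval-deterministic {k} {kg} g x eqw eqg) eq′

computes-C : ∀ {f g F G} → Computes f F → Computes g G → Computes (C f g) (F ∘ G)
computes-C f↓F g↓G x = ↓-C g↓G (f↓F _)

primRec : (ℕ → ℕ) → (ℕ → ℕ) → ℕ → ℕ → ℕ
primRec F G x zero    = F x
primRec F G x (suc y) = G ⟨ x , ⟨ y , primRec F G x y ⟩ ⟩

recWith-primRec : ∀ {f g F G} → Computes f F → Computes g G → ∀ x y →
                  ∃ λ k → ∀ {k′} → k ≤ k′ → recWith (eval k′ f) (eval k′ g) x y ≡ just (primRec F G x y)
recWith-primRec {f} f↓F g↓G x zero = proj₁ (f↓F x) , λ k≤k′ → eval-mono f k≤k′ x (proj₂ (f↓F x))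
recWith-primRec {f} {g} {F} {G} f↓F g↓G x (suc y)
  with recWith-primRec f↓F g↓G x y | g↓G ⟨ x , ⟨ y , primRec F G x y ⟩ ⟩
... | k , eq | kg , eqg = k ⊔ kg , eval-Rec
  where
  eval-Rec : ∀ {k′} → k ⊔ kg ≤ k′ → recWith (eval k′ f) (eval k′ g) x (suc y) ≡ just (primRec F G x (suc y))
  eval-Rec k⊔kg≤k′ rewrite eq (≤-trans (m≤m⊔n k kg) k⊔kg≤k′) = eval-mono g (≤-trans (m≤n⊔m k kg) k⊔kg≤k′) _ eqg

computes-Rec : ∀ {f g F G} → Computes f F → Computes g G → Computes (Rec f g) (λ x → primRec F G (π₁ x) (π₂ x))
computes-Rec f↓F g↓G x with recWith-primRec f↓F g↓G (π₁ x) (π₂ x)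
... | k , eq = suc k , eq ≤-refl

constCode : ℕ → Code
constCode zero    = Z
constCode (suc n) = C S (constCode n)

computes-const : ∀ n → Computes (constCode n) (λ _ → n)
computes-const zero    = computes-Z
computes-const (suc n) = computes-C computes-S (computes-const n)

caseℕ : ℕ → ℕ → (ℕ → ℕ) → ℕ
caseℕ zero    a b = a
caseℕ (suc n) a b = b n

ifZero : Code → Code → Code → Code
ifZero t a b = C (Rec a (C b (P L (C L R)))) (P I t)

computes-ifZero : ∀ {t a b T A B} → Computes t T → Computes a A → Computes b B →
                  Computes (ifZero t a b) (λ x → caseℕ (T x) (A x) (λ n → B ⟨ x , n ⟩))
computes-ifZero {T = T} {A} {B} t↓T a↓A b↓B =
  computes-ext (computes-C (computes-Rec a↓A (computes-C b↓B (computes-P computes-L (computes-C computes-L computes-R))))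
                           (computes-P computes-I t↓T))
               (λ x → primRec-case x (T x))
  where
  B′ : ℕ → ℕ
  B′ w = B ⟨ π₁ w , π₁ (π₂ w) ⟩
  primRec-case : ∀ x t → primRec A B′ (π₁ ⟨ x , t ⟩) (π₂ ⟨ x , t ⟩) ≡ caseℕ t (A x) (λ n → B ⟨ x , n ⟩)
  primRec-case x t rewrite π₁-⟨,⟩ x t | π₂-⟨,⟩ x t with t
  ... | zero  = refl
  ... | suc n rewrite π₁-⟨,⟩ x ⟨ n , primRec A B′ x n ⟩ | π₂-⟨,⟩ x ⟨ n , primRec A B′ x n ⟩
                    | π₁-⟨,⟩ n (primRec A B′ x n) = refl

predCode : Code
predCode = ifZero I Z R

computes-pred : Computes predCode pred
computes-pred = computes-ext (computes-ifZero computes-I computes-Z computes-R) case-pred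
  where
  case-pred : ∀ x → caseℕ x 0 (λ n → π₂ ⟨ x , n ⟩) ≡ pred x
  case-pred zero    = refl
  case-pred (suc n) = π₂-⟨,⟩ (suc n) n

monusCode : Code
monusCode = Rec I (C predCode (C R R))

computes-monus : Computes monusCode (λ z → π₁ z ∸ π₂ z)
computes-monus = computes-ext (computes-Rec computes-I (computes-C computes-pred (computes-C computes-R computes-R)))
                              (λ z → primRec-monus (π₁ z) (π₂ z))
  where
  pred∘π₂∘π₂ : ℕ → ℕ
  pred∘π₂∘π₂ w = pred (π₂ (π₂ w))
  primRec-monus : ∀ x y → primRec (λ x → x) pred∘π₂∘π₂ x y ≡ x ∸ y
  primRec-monus x zero    = refl
  primRec-monus x (suc y) rewrite π₂-⟨,⟩ x ⟨ y , primRec (λ x → x) pred∘π₂∘π₂ x y ⟩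
                                | π₂-⟨,⟩ y (primRec (λ x → x) pred∘π₂∘π₂ x y)
                                | primRec-monus x y = pred[m∸n]≡m∸[1+n] x y

encodeMaybe : Maybe ℕ → ℕ
encodeMaybe nothing  = 0
encodeMaybe (just v) = suc v

evalWithFuel : Code → ℕ → ℕ
evalWithFuel c z = encodeMaybe (eval (π₂ z) c (π₁ z))

evalWithSucFuel : Code → ℕ → ℕ
evalWithSucFuel c z = encodeMaybe (eval (suc (π₂ z)) c (π₁ z))

fromSucFuel : Code → Code
fromSucFuel b = Rec Z (C b (P L (C L R)))

computes-fromSucFuel : ∀ {b} c → Computes b (evalWithSucFuel c) → Computes (fromSucFuel b) (evalWithFuel c)
computes-fromSucFuel c b↓ =
  computes-ext (computes-Rec computes-Z (computes-C b↓ (computes-P computes-L (computes-C computes-L computes-R))))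
               (λ z → primRec-fuel (π₁ z) (π₂ z))
  where
  step : ℕ → ℕ
  step w = evalWithSucFuel c ⟨ π₁ w , π₁ (π₂ w) ⟩
  primRec-fuel : ∀ x k → primRec (λ _ → 0) step x k ≡ encodeMaybe (eval k c x)
  primRec-fuel x zero    = refl
  primRec-fuel x (suc k) rewrite π₁-⟨,⟩ x ⟨ k , primRec (λ _ → 0) step x k ⟩
                               | π₂-⟨,⟩ x ⟨ k , primRec (λ _ → 0) step x k ⟩
                               | π₁-⟨,⟩ k (primRec (λ _ → 0) step x k)
                               | π₁-⟨,⟩ x k | π₂-⟨,⟩ x k = refl

searchIndexCode : Code
searchIndexCode = C monusCode (P (C R L) (C S (C L R)))

searchIndex : ℕ → ℕ
searchIndex s = π₂ (π₁ s) ∸ suc (π₁ (π₂ s))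

computes-searchIndex : Computes searchIndexCode searchIndex
computes-searchIndex =
  computes-ext (computes-C computes-monus (computes-P (computes-C computes-R computes-L)
                                                      (computes-C computes-S (computes-C computes-L computes-R))))
               (λ s → cong₂ _∸_ (π₁-⟨,⟩ (π₂ (π₁ s)) _) (π₂-⟨,⟩ (π₂ (π₁ s)) _))

mutual
  sucFuelEvaluator : Code → Code
  sucFuelEvaluator Z         = constCode 1
  sucFuelEvaluator S         = C S (C S L)
  sucFuelEvaluator I         = C S L
  sucFuelEvaluator L         = C S (C L L)
  sucFuelEvaluator R         = C S (C R L)
  sucFuelEvaluator (P f g)   =
    ifZero (fuelEvaluator f) Z (ifZero (C (fuelEvaluator g) L) Z (C S (P (C R L) R)))
  sucFuelEvaluator (C f g)   = ifZero (fuelEvaluator g) Z (C (fuelEvaluator f) (P R (C R L)))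
  sucFuelEvaluator (Rec f g) = C (Rec (fuelEvaluator f) (recStep g)) (P (P (C L L) R) (C R L))
  sucFuelEvaluator (Mu f)    = C (Rec Z (muStep f)) (P I R)

  fuelEvaluator : Code → Code
  fuelEvaluator c = fromSucFuel (sucFuelEvaluator c)

  recStep : Code → Code
  recStep g = ifZero (C R R) Z
    (C (fuelEvaluator g) (P (P (C L (C L L)) (P (C L (C R L)) R)) (C R (C L L))))

  muStep : Code → Code
  muStep f = ifZero (C (fuelEvaluator f) (P (P (C L L) searchIndexCode) (C R L))) Z
    (ifZero R (C S (C searchIndexCode L)) (C R (C R (C L L))))

evalWithSucFuel-P : ∀ f g z →
  caseℕ (evalWithFuel f z) 0 (λ n →
    caseℕ (evalWithFuel g (π₁ ⟨ z , n ⟩)) 0 (λ m →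
      suc ⟨ π₂ (π₁ ⟨ ⟨ z , n ⟩ , m ⟩) , π₂ ⟨ ⟨ z , n ⟩ , m ⟩ ⟩))
  ≡ evalWithSucFuel (P f g) z
evalWithSucFuel-P f g z with eval (π₂ z) f (π₁ z)
... | nothing = refl
... | just a rewrite π₁-⟨,⟩ z a with eval (π₂ z) g (π₁ z)
...   | nothing = refl
...   | just b rewrite π₁-⟨,⟩ ⟨ z , a ⟩ b | π₂-⟨,⟩ z a | π₂-⟨,⟩ ⟨ z , a ⟩ b = refl

evalWithSucFuel-C : ∀ f g z →
  caseℕ (evalWithFuel g z) 0 (λ n → evalWithFuel f ⟨ π₂ ⟨ z , n ⟩ , π₂ (π₁ ⟨ z , n ⟩) ⟩)
  ≡ evalWithSucFuel (C f g) z
evalWithSucFuel-C f g z with eval (π₂ z) g (π₁ z)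
... | nothing = refl
... | just v rewrite π₂-⟨,⟩ z v | π₁-⟨,⟩ z v | π₁-⟨,⟩ v (π₂ z) | π₂-⟨,⟩ v (π₂ z) = refl

recStepFn : Code → ℕ → ℕ
recStepFn g s = caseℕ (π₂ (π₂ s)) 0 (λ n →
  evalWithFuel g ⟨ ⟨ π₁ (π₁ (π₁ ⟨ s , n ⟩)) , ⟨ π₁ (π₂ (π₁ ⟨ s , n ⟩)) , π₂ ⟨ s , n ⟩ ⟩ ⟩ , π₂ (π₁ (π₁ ⟨ s , n ⟩)) ⟩)

primRec-recStep : ∀ f g x k y →
  primRec (evalWithFuel f) (recStepFn g) ⟨ x , k ⟩ y ≡ encodeMaybe (recWith (eval k f) (eval k g) x y)
primRec-recStep f g x k zero rewrite π₁-⟨,⟩ x k | π₂-⟨,⟩ x k = refl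
primRec-recStep f g x k (suc y)
  rewrite π₂-⟨,⟩ ⟨ x , k ⟩ ⟨ y , primRec (evalWithFuel f) (recStepFn g) ⟨ x , k ⟩ y ⟩
        | π₂-⟨,⟩ y (primRec (evalWithFuel f) (recStepFn g) ⟨ x , k ⟩ y)
        | primRec-recStep f g x k y
  with recWith (eval k f) (eval k g) x y
... | nothing = refl
... | just h rewrite π₁-⟨,⟩ ⟨ ⟨ x , k ⟩ , ⟨ y , suc h ⟩ ⟩ h | π₂-⟨,⟩ ⟨ ⟨ x , k ⟩ , ⟨ y , suc h ⟩ ⟩ h
                   | π₁-⟨,⟩ ⟨ x , k ⟩ ⟨ y , suc h ⟩ | π₂-⟨,⟩ ⟨ x , k ⟩ ⟨ y , suc h ⟩
                   | π₁-⟨,⟩ x k | π₂-⟨,⟩ x k | π₁-⟨,⟩ y (suc h)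
                   | π₁-⟨,⟩ ⟨ x , ⟨ y , h ⟩ ⟩ k | π₂-⟨,⟩ ⟨ x , ⟨ y , h ⟩ ⟩ k = refl

evalWithSucFuel-Rec : ∀ f g z →
  primRec (evalWithFuel f) (recStepFn g) (π₁ ⟨ ⟨ π₁ (π₁ z) , π₂ z ⟩ , π₂ (π₁ z) ⟩) (π₂ ⟨ ⟨ π₁ (π₁ z) , π₂ z ⟩ , π₂ (π₁ z) ⟩)
  ≡ evalWithSucFuel (Rec f g) z
evalWithSucFuel-Rec f g z
  rewrite π₁-⟨,⟩ ⟨ π₁ (π₁ z) , π₂ z ⟩ (π₂ (π₁ z)) | π₂-⟨,⟩ ⟨ π₁ (π₁ z) , π₂ z ⟩ (π₂ (π₁ z))
  = primRec-recStep f g (π₁ (π₁ z)) (π₂ z) (π₂ (π₁ z))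

muStepFn : Code → ℕ → ℕ
muStepFn f s = caseℕ (evalWithFuel f ⟨ ⟨ π₁ (π₁ s) , searchIndex s ⟩ , π₂ (π₁ s) ⟩) 0 (λ n →
  caseℕ (π₂ ⟨ s , n ⟩) (suc (searchIndex (π₁ ⟨ s , n ⟩))) (λ m → π₂ (π₂ (π₁ (π₁ ⟨ ⟨ s , n ⟩ , m ⟩)))))

m+n≡o⇒o∸n≡m : ∀ m n o → m + n ≡ o → o ∸ n ≡ m
m+n≡o⇒o∸n≡m m n o refl = m+n∸n≡m m n

muStepFn-step : ∀ f z r prev i → i + suc r ≡ π₂ z →
  muStepFn f ⟨ z , ⟨ r , prev ⟩ ⟩
  ≡ caseℕ (encodeMaybe (eval (π₂ z) f ⟨ π₁ z , i ⟩)) 0 (λ n → caseℕ n (suc i) (λ _ → prev))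
muStepFn-step f z r prev i i+1+r≡k
  rewrite π₁-⟨,⟩ z ⟨ r , prev ⟩ | π₂-⟨,⟩ z ⟨ r , prev ⟩ | π₁-⟨,⟩ r prev
        | m+n≡o⇒o∸n≡m i (suc r) (π₂ z) i+1+r≡k
        | π₁-⟨,⟩ ⟨ π₁ z , i ⟩ (π₂ z) | π₂-⟨,⟩ ⟨ π₁ z , i ⟩ (π₂ z)
  with eval (π₂ z) f ⟨ π₁ z , i ⟩
... | nothing = refl
... | just zero
  rewrite π₂-⟨,⟩ ⟨ z , ⟨ r , prev ⟩ ⟩ 0 | π₁-⟨,⟩ ⟨ z , ⟨ r , prev ⟩ ⟩ 0
        | π₁-⟨,⟩ z ⟨ r , prev ⟩ | π₂-⟨,⟩ z ⟨ r , prev ⟩ | π₁-⟨,⟩ r prev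
        | m+n≡o⇒o∸n≡m i (suc r) (π₂ z) i+1+r≡k = refl
... | just (suc w)
  rewrite π₂-⟨,⟩ ⟨ z , ⟨ r , prev ⟩ ⟩ (suc w) | π₁-⟨,⟩ ⟨ ⟨ z , ⟨ r , prev ⟩ ⟩ , suc w ⟩ w
        | π₁-⟨,⟩ ⟨ z , ⟨ r , prev ⟩ ⟩ (suc w) | π₂-⟨,⟩ z ⟨ r , prev ⟩ | π₂-⟨,⟩ r prev = refl

-- the search runs upwards from i while the recursion on the remaining budget r runs downwards
primRec-muStep : ∀ f z r i → i + r ≡ π₂ z →
  primRec (λ _ → 0) (muStepFn f) z r ≡ encodeMaybe (searchWith (eval (π₂ z) f) (π₁ z) r i)
primRec-muStep f z zero    i _          = refl
primRec-muStep f z (suc r) i i+1+r≡k =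
  trans (muStepFn-step f z r _ i i+1+r≡k)
        (search-step (primRec-muStep f z r (suc i) (trans (sym (+-suc i r)) i+1+r≡k)))
  where
  search-step : ∀ {prev} → prev ≡ encodeMaybe (searchWith (eval (π₂ z) f) (π₁ z) r (suc i)) →
    caseℕ (encodeMaybe (eval (π₂ z) f ⟨ π₁ z , i ⟩)) 0 (λ n → caseℕ n (suc i) (λ _ → prev))
    ≡ encodeMaybe (searchWith (eval (π₂ z) f) (π₁ z) (suc r) i)
  search-step refl with eval (π₂ z) f ⟨ π₁ z , i ⟩
  ... | nothing      = refl
  ... | just zero    = refl
  ... | just (suc _) = refl

evalWithSucFuel-Mu : ∀ f z →
  primRec (λ _ → 0) (muStepFn f) (π₁ ⟨ z , π₂ z ⟩) (π₂ ⟨ z , π₂ z ⟩) ≡ evalWithSucFuel (Mu f) z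
evalWithSucFuel-Mu f z rewrite π₁-⟨,⟩ z (π₂ z) | π₂-⟨,⟩ z (π₂ z) = primRec-muStep f z (π₂ z) 0 refl

mutual
  computes-sucFuelEvaluator : ∀ c → Computes (sucFuelEvaluator c) (evalWithSucFuel c)
  computes-sucFuelEvaluator Z = computes-const 1
  computes-sucFuelEvaluator S = computes-C computes-S (computes-C computes-S computes-L)
  computes-sucFuelEvaluator I = computes-C computes-S computes-L
  computes-sucFuelEvaluator L = computes-C computes-S (computes-C computes-L computes-L)
  computes-sucFuelEvaluator R = computes-C computes-S (computes-C computes-R computes-L)
  computes-sucFuelEvaluator (P f g) = computes-ext
    (computes-ifZero (computes-fuelEvaluator f) computes-Z
      (computes-ifZero (computes-C (computes-fuelEvaluator g) computes-L) computes-Z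
        (computes-C computes-S (computes-P (computes-C computes-R computes-L) computes-R))))
    (evalWithSucFuel-P f g)
  computes-sucFuelEvaluator (C f g) = computes-ext
    (computes-ifZero (computes-fuelEvaluator g) computes-Z
      (computes-C (computes-fuelEvaluator f) (computes-P computes-R (computes-C computes-R computes-L))))
    (evalWithSucFuel-C f g)
  computes-sucFuelEvaluator (Rec f g) = computes-ext
    (computes-C (computes-Rec (computes-fuelEvaluator f) (computes-recStep g))
                (computes-P (computes-P (computes-C computes-L computes-L) computes-R) (computes-C computes-R computes-L)))
    (evalWithSucFuel-Rec f g)
  computes-sucFuelEvaluator (Mu f) = computes-ext
    (computes-C (computes-Rec computes-Z (computes-muStep f)) (computes-P computes-I computes-R))
    (evalWithSucFuel-Mu f)

  computes-fuelEvaluator : ∀ c → Computes (fuelEvaluator c) (evalWithFuel c)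
  computes-fuelEvaluator c = computes-fromSucFuel c (computes-sucFuelEvaluator c)

  computes-recStep : ∀ g → Computes (recStep g) (recStepFn g)
  computes-recStep g = computes-ifZero (computes-C computes-R computes-R) computes-Z
    (computes-C (computes-fuelEvaluator g)
      (computes-P (computes-P (computes-C computes-L (computes-C computes-L computes-L))
                              (computes-P (computes-C computes-L (computes-C computes-R computes-L)) computes-R))
                  (computes-C computes-R (computes-C computes-L computes-L))))

  computes-muStep : ∀ f → Computes (muStep f) (muStepFn f)
  computes-muStep f = computes-ifZero
    (computes-C (computes-fuelEvaluator f)
      (computes-P (computes-P (computes-C computes-L computes-L) computes-searchIndex) (computes-C computes-R computes-L)))
    computes-Z
    (computes-ifZero computes-R (computes-C computes-S (computes-C computes-searchIndex computes-L))
      (computes-C computes-R (computes-C computes-R (computes-C computes-L computes-L))))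

constIndexCode : Code
constIndexCode = C (Rec Z (P (constCode 6) (P (constCode (encode S)) (C R R)))) (P Z I)

computes-constIndex : Computes constIndexCode (encode ∘ constCode)
computes-constIndex =
  computes-ext (computes-C (computes-Rec computes-Z (computes-P (computes-const 6)
                                                       (computes-P (computes-const (encode S)) (computes-C computes-R computes-R))))
                           (computes-P computes-Z computes-I))
               primRec-constIndex
  where
  step : ℕ → ℕ
  step w = ⟨ 6 , ⟨ encode S , π₂ (π₂ w) ⟩ ⟩
  primRec-encode : ∀ y → primRec (λ _ → 0) step 0 y ≡ encode (constCode y)
  primRec-encode zero    = refl
  primRec-encode (suc y) rewrite π₂-⟨,⟩ 0 ⟨ y , primRec (λ _ → 0) step 0 y ⟩
                               | π₂-⟨,⟩ y (primRec (λ _ → 0) step 0 y) | primRec-encode y = refl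
  primRec-constIndex : ∀ x → primRec (λ _ → 0) step (π₁ ⟨ 0 , x ⟩) (π₂ ⟨ 0 , x ⟩) ≡ encode (constCode x)
  primRec-constIndex x rewrite π₁-⟨,⟩ 0 x | π₂-⟨,⟩ 0 x = primRec-encode x

diagonalIndex : ℕ → ℕ
diagonalIndex x = ⟨ 6 , ⟨ x , ⟨ 5 , ⟨ encode (constCode x) , encode I ⟩ ⟩ ⟩ ⟩

decode-diagonalIndex : ∀ x → decode (diagonalIndex x) ≡ C (decode x) (P (constCode x) I)
decode-diagonalIndex x =
  trans (decode-node C decodesAs-C _ _)
        (cong (C (decode x)) (trans (decode-node P decodesAs-P _ _) (cong₂ P (decode-encode (constCode x)) refl)))

diagonalIndexCode : Code
diagonalIndexCode = P (constCode 6) (P I (P (constCode 5) (P constIndexCode (constCode (encode I)))))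

computes-diagonalIndex : Computes diagonalIndexCode diagonalIndex
computes-diagonalIndex =
  computes-P (computes-const 6)
    (computes-P computes-I (computes-P (computes-const 5) (computes-P computes-constIndex (computes-const (encode I)))))

zeroOrDiverge : Code
zeroOrDiverge = Mu L

zeroOrDiverge-halts⇒0 : ∀ k t {v} → eval k zeroOrDiverge t ≡ just v → t ≡ 0
zeroOrDiverge-halts⇒0 (suc k) zero    eq = refl
zeroOrDiverge-halts⇒0 (suc k) (suc t) eq = ⊥-elim (search-fails k k 0 eq)
  where
  search-fails : ∀ k r i {v} → searchWith (eval k L) (suc t) r i ≡ just v → ⊥
  search-fails (suc k) (suc r) i eq rewrite π₁-⟨,⟩ (suc t) i = search-fails (suc k) r (suc i) eq

-- body, run on ⟨q , i⟩ for an index q of body itself, recomputes watcher = diagonalIndex q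
-- and watches e on ⟨a , ⟨watcher , r⟩⟩ for i steps.
module Watcher (e a r : ℕ) where

  observation : ℕ → ℕ
  observation w = evalWithFuel (decode e) ⟨ ⟨ a , ⟨ diagonalIndex (π₁ w) , r ⟩ ⟩ , π₂ w ⟩

  observationCode : Code
  observationCode =
    C (fuelEvaluator (decode e)) (P (P (constCode a) (P (C diagonalIndexCode L) (constCode r))) R)

  computes-observation : Computes observationCode observation
  computes-observation = computes-C (computes-fuelEvaluator (decode e))
    (computes-P (computes-P (computes-const a) (computes-P (computes-C computes-diagonalIndex computes-L)
                                                           (computes-const r)))
                computes-R)

  body : Code
  body = C zeroOrDiverge observationCode

  module _ (q : ℕ) (decode-q : decode q ≡ body) where

    watcher : ℕ
    watcher = diagonalIndex q

    query : ℕ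
    query = ⟨ a , ⟨ watcher , r ⟩ ⟩

    observation-at : ∀ i → observation ⟨ q , i ⟩ ≡ encodeMaybe (eval i (decode e) query)
    observation-at i rewrite π₁-⟨,⟩ q i | π₂-⟨,⟩ q i | π₁-⟨,⟩ query i | π₂-⟨,⟩ query i = refl

    decode-watcher : decode watcher ≡ C body (P (constCode q) I)
    decode-watcher = trans (decode-diagonalIndex q) (cong (λ c → C c (P (constCode q) I)) decode-q)

    computes-pairing : Computes (P (constCode q) I) (λ i → ⟨ q , i ⟩)
    computes-pairing = computes-P (computes-const q) computes-I

    watcher-total : (∀ i → eval i (decode e) query ≡ nothing) → ∀ i → watcher · i ↓ 0
    watcher-total silent i = subst (λ c → c ⟦ i ⟧↓ 0) (sym decode-watcher)
      (↓-C computes-pairing (↓-C computes-observation (2 , zeroOrDiverge-halts)))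
      where
      zeroOrDiverge-halts : eval 2 zeroOrDiverge (observation ⟨ q , i ⟩) ≡ just 0
      zeroOrDiverge-halts rewrite observation-at i | silent i = refl

    watcher-halts⇒silent : ∀ i {v} → watcher · i ↓ v → eval i (decode e) query ≡ nothing
    watcher-halts⇒silent i {v} (k , eq) =
      encodeMaybe≡0 (trans (sym (observation-at i)) (zeroOrDiverge-halts⇒0 (proj₁ halts) _ (proj₂ halts)))
      where
      body-halts : body ⟦ ⟨ q , i ⟩ ⟧↓ v
      body-halts = ↓-C⁻¹ {f = body} computes-pairing (k , subst (λ c → eval k c i ≡ just v) decode-watcher eq)
      halts : zeroOrDiverge ⟦ observation ⟨ q , i ⟩ ⟧↓ v
      halts = ↓-C⁻¹ {f = zeroOrDiverge} computes-observation body-halts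
      encodeMaybe≡0 : ∀ {m} → encodeMaybe m ≡ 0 → m ≡ nothing
      encodeMaybe≡0 {nothing} _ = refl

0≤eps : ∀ j → 0ℚ ℚ.≤ eps j
0≤eps zero    = from-yes (0ℚ ℚ.≤? 1ℚ)
0≤eps (suc j) = ℚₚ.*-monoˡ-≤-nonNeg ½ (0≤eps j)

constantZero-DomR : ∀ n → (∀ i → n · i ↓ 0) → DomR n
constantZero-DomR n φₙ≡0 = record { total = λ i → 0 , φₙ≡0 i ; cauchy = λ i j _ → 0≤eps j }

zeroℝ : ℝ
zeroℝ = record { seq = λ _ → 0ℚ ; reg = λ i j _ → 0≤eps j }

-- centre index 0 decodes to Z, and cQ 2 = 1, cQ 9 = 2
unitInterval : ℕ
unitInterval = ⟨ 0 , 2 ⟩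

unitInterval-Domβ : Domβ unitInterval
unitInterval-Domβ = constantZero-DomR 0 (λ i → 1 , refl) , from-yes (0ℚ ℚ.<? cQ 2)

0∈unitInterval : zeroℝ ∈β̃ unitInterval
0∈unitInterval = unitInterval-Domβ , 2 , from-yes ((eps 2 ℚ.+ eps 2) ℚ.<? (cQ 2 ℚ.- ℚ.∣ cQ 0 ℚ.- 0ℚ ∣))

unitInterval-⊆̊ : ∀ b → (∀ i → π₁ b · i ↓ 0) → π₂ b ≡ 9 →
                 Σ (Domβ b) λ db → StrongIncl unitInterval b unitInterval-Domβ db
unitInterval-⊆̊ b φ≡0 π₂b≡9 =
  (constantZero-DomR (π₁ b) φ≡0 , subst (λ m → 0ℚ ℚ.< cQ m) (sym π₂b≡9) (from-yes (0ℚ ℚ.<? cQ 9))) ,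
  2 , subst (λ m → (eps 2 ℚ.+ eps 2) ℚ.< ((cQ m ℚ.- cQ 2) ℚ.- ℚ.∣ cQ 0 ℚ.- cQ 0 ∣)) (sym π₂b≡9)
            (from-yes ((eps 2 ℚ.+ eps 2) ℚ.<? ((cQ 9 ℚ.- cQ 2) ℚ.- ℚ.∣ cQ 0 ℚ.- cQ 0 ∣)))

¬Halts⇒silent : ∀ {e x} → ¬ Halts e x → ∀ k → eval k (decode e) x ≡ nothing
¬Halts⇒silent {e} {x} ¬halts k with eval k (decode e) x in eq
... | nothing = refl
... | just y  = ⊥-elim (¬halts (y , k , eq))

-- The index q of body is a parameter: unfolding encode body during conversion checks is
-- prohibitively expensive.
watcher-refutes : ∀ {R′ : ℕ → ℕ → Set} {e} → (∀ a b → R′ a b → a ⊆β̃ b) → Extends R′ →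
                  (∀ a b → R′ a b ⇔ Halts e ⟨ a , b ⟩) →
                  ∀ q → decode q ≡ Watcher.body e unitInterval 9 → ⊥
watcher-refutes {R′} {e} R′⇒⊆β̃ extends semidecides q decode-q = ¬halts (halts ¬halts)
  where
  open Watcher e unitInterval 9
  p : ℕ
  p = watcher q decode-q

  b : ℕ
  b = ⟨ p , 9 ⟩

  halts⇒DomR : Halts e ⟨ unitInterval , b ⟩ → DomR p
  halts⇒DomR h = subst DomR (π₁-⟨,⟩ p 9)
    (proj₁ (proj₁ (R′⇒⊆β̃ _ _ (Equivalence.from (semidecides unitInterval b) h) zeroℝ 0∈unitInterval)))

  ¬halts : ¬ Halts e ⟨ unitInterval , b ⟩
  ¬halts h@(_ , k , halts-at-k) = case trans (sym halts-at-k) silent-at-k of λ ()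
    where
    silent-at-k : eval k (decode e) ⟨ unitInterval , b ⟩ ≡ nothing
    silent-at-k = watcher-halts⇒silent q decode-q k (proj₂ (DomR.total (halts⇒DomR h) k))

  halts : ¬ Halts e ⟨ unitInterval , b ⟩ → Halts e ⟨ unitInterval , b ⟩
  halts ¬h = Equivalence.to (semidecides unitInterval b)
                (Equivalence.from (extends unitInterval b unitInterval-Domβ (proj₁ ⊆̊)) (proj₂ ⊆̊))
    where
    φ-b≡0 : ∀ i → π₁ b · i ↓ 0
    φ-b≡0 = subst (λ n → ∀ i → n · i ↓ 0) (sym (π₁-⟨,⟩ p 9)) (watcher-total q decode-q (¬Halts⇒silent ¬h))
    ⊆̊ : Σ (Domβ b) λ db → StrongIncl unitInterval b unitInterval-Domβ db
    ⊆̊ = unitInterval-⊆̊ b φ-b≡0 (π₂-⟨,⟩ p 9)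

proposition6p3 : ¬ (Σ (ℕ → ℕ → Set) λ R′ →
                        IsStrongInclusionβ̃ R′ × Extends R′ × SemiDecidable R′)
proposition6p3 (R′ , (_ , R′⇒⊆β̃) , extends , e , semidecides) =
  watcher-refutes R′⇒⊆β̃ extends semidecides (encode body) (decode-encode body)
  where open Watcher e unitInterval 9
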